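{- Let $\ell\geq 3$ be prime, let $q\neq\ell$ be a prime, and let $C_\ell$ be the nonsingular curve with affine model $y^\ell=x(x^\ell-1)$. If $q\equiv 1\pmod{\ell}$ but $q\not\equiv 1\pmod{\ell^2}$, then $\#C_\ell(\mathbb{F}_q)=q+1$.
   Context: $\#C_\ell(\mathbb{F}_q)$ is the number of $\mathbb{F}_q$-rational points of the nonsingular projective curve, i.e., the affine solutions $(x,y)\in\mathbb{F}_q^2$ together with the single point at infinity. -}

module Defs where

open import Data.Nat using (ℕ; _+_; _*_; _∸_; _^_; NonZero)
open import Data.Nat.DivMod using (_%_)
open import Data.Nat.Properties using (_≟_)
open import Data.Nat.Primality using (Prime; prime⇒nonZero)
open import Data.List using (List; length; filter; upTo; cartesianProduct)
open import Data.Product using (_×_; _,_)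
open import Relation.Nullary using (Dec)

-- Affine equation y^ℓ = x (x^ℓ - 1) over 𝔽_q = ℤ/qℤ (q prime),
-- with elements represented by 0 … q-1, and x^ℓ - 1 computed as x^ℓ + (q - 1) mod q.
onAffineCurve : (ℓ q : ℕ) → .{{NonZero q}} → ℕ × ℕ → Set
onAffineCurve ℓ q (x , y) = (y ^ ℓ) % q Relation.Binary.PropositionalEquality.≡ (x * (x ^ ℓ + (q ∸ 1))) % q
  where import Relation.Binary.PropositionalEquality

onAffineCurve? : (ℓ q : ℕ) → .{{_ : NonZero q}} → (p : ℕ × ℕ) → Dec (onAffineCurve ℓ q p)
onAffineCurve? ℓ q (x , y) = (y ^ ℓ) % q ≟ (x * (x ^ ℓ + (q ∸ 1))) % q

-- #C_ℓ(𝔽_q): affine 𝔽_q-solutions (x,y) plus the single point at infinity.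
#C : (ℓ q : ℕ) → Prime q → ℕ
#C ℓ q qp = length (filter (onAffineCurve? ℓ q) (cartesianProduct (upTo q) (upTo q))) + 1
  where instance
    _ : NonZero q
    _ = prime⇒nonZero qp

{-# OPTIONS --safe #-}
module Submission where

-- Let F x = x (x^ℓ - 1) and let N b be the number of y ∈ 𝔽_q with y^ℓ = b, so that the affine
-- count is ∑ₓ N (F x). For an ℓ-th root of unity η we have F (η x) = η F x, so substituting
-- x ↦ ηⁱ x gives ℓ ∑ₓ N (F x) = ∑ₓ T (F x) with T a = ∑_{i<ℓ} N (ηⁱ a). Summed over all a, T
-- gives ℓ q; hence if T a ≥ ℓ for every a, then T is constantly ℓ and the affine count is q.
-- Write q - 1 = m ℓ, where ℓ ∤ m because q ≢ 1 mod ℓ². Then the nonzero ℓ-th powers are the b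
-- with bᵐ = 1, and if η has order ℓ then so has ηᵐ, whose powers exhaust the ℓ-th roots of
-- unity. So for a ≠ 0 some ηⁱ a is an ℓ-th power w^ℓ, which has the ℓ distinct roots w ηʲ.

open import Defs
open import Data.Fin using (Fin; zero; suc; toℕ; fromℕ; fromℕ<; inject₁)
open import Data.Fin.Permutation using (Permutation; permutation)
open import Data.Fin.Properties
  using (suc-injective; toℕ-injective; toℕ<n; toℕ-fromℕ; toℕ-fromℕ<; toℕ-inject₁; any?)
  renaming (_≟_ to _≟ᶠ_)
open import Data.List using (List; length; filter; map; _++_; applyUpTo; upTo; cartesianProduct)
open import Data.List.Properties using (length-++; filter-++; map-upTo)
open import Data.Nat
  using (ℕ; zero; suc; _+_; _*_; _∸_; _^_; _⊔_; _≤_; _<_; z≤n; s≤s; z<s; NonZero; >-nonZero⁻¹; nonTrivial⇒n>1)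
open import Data.Nat.Coprimality using (Coprime; coprime-Bézout; prime⇒coprime)
open import Data.Nat.DivMod
  using (_%_; _mod_; m%n%n≡m%n; m%n<n; m<n⇒m%n≡m; %-distribˡ-+; %-distribˡ-*; %-remove-+ʳ)
open import Data.Nat.Divisibility using (_∣_; divides; ∣⇒≤; m∣m*n; *-monoˡ-∣; n∣m⇒m%n≡0; m%n≡0⇒n∣m)
open import Data.Nat.GCD using (module Bézout)
open import Data.Nat.Primality using (Prime; prime⇒nonZero; prime⇒nonTrivial; prime⇒irreducible)
open import Data.Nat.Properties hiding (suc-injective)
open import Data.Nat.Solver using (module +-*-Solver)
open import Data.Product using (∃-syntax; _×_; _,_; proj₁; proj₂)
open import Data.Sum using (inj₁; inj₂)
open import Function using (_∘_; id)
open import Level using (Level; 0ℓ)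
open import Relation.Binary using (Setoid; _Preserves_⟶_; tri<; tri≈; tri>)
import Relation.Binary.Construct.On as On
import Relation.Binary.Reasoning.Setoid as SetoidReasoning
open import Relation.Binary.PropositionalEquality
open import Relation.Nullary using (¬_; Dec; yes; no; contradiction; _×-dec_; ¬?)
open import Relation.Nullary.Decidable using (decidable-stable)
open import Relation.Unary using (Pred; Decidable)

open import Algebra.Properties.Semiring.Sum +-*-semiring
  using (sum; sum-syntax; sum-cong-≗; ∑-comm; sum-permute; sum-init-last; *-distribˡ-sum)
import Algebra.Properties.CommutativeMonoid.Sum as CommutativeMonoidSum
open +-*-Solver using (solve; _:*_; _:+_; _:=_; con)

private
  variable
    a p : Level
    A B : Set a
    k n : ℕ

𝟙 : Dec A → ℕ
𝟙 (yes _) = 1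
𝟙 (no _)  = 0

𝟙-cong : (a? : Dec A) (b? : Dec B) → (A → B) → (B → A) → 𝟙 a? ≡ 𝟙 b?
𝟙-cong (yes _) (yes _) _   _   = refl
𝟙-cong (yes a) (no ¬b) A→B _   = contradiction (A→B a) ¬b
𝟙-cong (no ¬a) (yes b) _   B→A = contradiction (B→A b) ¬a
𝟙-cong (no _)  (no _)  _   _   = refl

count : {P : Pred (Fin n) p} → Decidable P → ℕ
count {n} P? = ∑[ i < n ] 𝟙 (P? i)

sum-const : ∀ n c → ∑[ i < n ] c ≡ n * c
sum-const zero    c = refl
sum-const (suc n) c = cong (c +_) (sum-const n c)

sum-mono-≤ : (f g : Fin n → ℕ) → (∀ i → f i ≤ g i) → sum f ≤ sum g
sum-mono-≤ {zero}  f g f≤g = z≤n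
sum-mono-≤ {suc n} f g f≤g = +-mono-≤ (f≤g zero) (sum-mono-≤ (f ∘ suc) (g ∘ suc) (f≤g ∘ suc))

≤-sum : (f : Fin n → ℕ) (i : Fin n) → f i ≤ sum f
≤-sum f zero    = m≤m+n (f zero) _
≤-sum f (suc i) = ≤-trans (≤-sum (f ∘ suc) i) (m≤n+m _ (f zero))

n*c≤sum : ∀ {c} (f : Fin n → ℕ) → (∀ i → c ≤ f i) → n * c ≤ sum f
n*c≤sum {n} {c} f c≤f = subst (_≤ sum f) (sum-const n c) (sum-mono-≤ (λ _ → c) f c≤f)

sum≡n*c⇒≡c : ∀ {c} (f : Fin n → ℕ) → (∀ i → c ≤ f i) → sum f ≡ n * c → ∀ i → f i ≡ c
sum≡n*c⇒≡c {suc n} {c} f c≤f sum≡ = go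
  where
  head≡ : f zero ≡ c
  head≡ = ≤-antisym
    (+-cancelʳ-≤ _ _ _ (≤-trans (≤-reflexive sum≡) (+-monoʳ-≤ c (n*c≤sum (f ∘ suc) (c≤f ∘ suc)))))
    (c≤f zero)
  go : ∀ i → f i ≡ c
  go zero    = head≡
  go (suc i) = sum≡n*c⇒≡c (f ∘ suc) (c≤f ∘ suc) (+-cancelˡ-≡ c _ _ (trans (cong (_+ _) (sym head≡)) sum≡)) i

1≤count : {P : Pred (Fin n) p} (P? : Decidable P) {i : Fin n} → P i → 1 ≤ count P?
1≤count P? {i} pᵢ = ≤-trans (≤-reflexive (𝟙-cong (yes pᵢ) (P? i) id (λ _ → pᵢ))) (≤-sum _ i)

count-none : {P : Pred (Fin n) p} (P? : Decidable P) → (∀ i → ¬ P i) → count P? ≡ 0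
count-none {zero}  P? ¬P = refl
count-none {suc n} P? ¬P with P? zero
... | yes p = contradiction p (¬P zero)
... | no  _ = count-none (P? ∘ suc) (¬P ∘ suc)

count≤1 : {P : Pred (Fin n) p} (P? : Decidable P) → (∀ {i j} → P i → P j → i ≡ j) → count P? ≤ 1
count≤1 {zero}  P? unique = z≤n
count≤1 {suc n} P? unique with P? zero
... | yes p = ≤-reflexive (cong suc (count-none (P? ∘ suc) (λ i pᵢ → 0≢suc (unique p pᵢ))))
  where
  0≢suc : {i : Fin n} → zero ≢ suc i
  0≢suc ()
... | no  _ = count≤1 (P? ∘ suc) (λ pᵢ pⱼ → suc-injective (unique pᵢ pⱼ))

count-≡ : (j : Fin n) → count (_≟ᶠ j) ≡ 1
count-≡ {suc n} zero    = cong suc (count-none {n} (λ i → suc i ≟ᶠ zero) (λ i ()))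
count-≡ {suc n} (suc j) =
  trans (sum-cong-≗ (λ i → 𝟙-cong (suc i ≟ᶠ suc j) (i ≟ᶠ j) suc-injective (cong suc))) (count-≡ j)

count-unique : {P : Pred (Fin n) p} (P? : Decidable P) (j : Fin n) →
               (∀ {i} → P i → i ≡ j) → P j → count P? ≡ 1
count-unique P? j only pⱼ =
  trans (sum-cong-≗ (λ i → 𝟙-cong (P? i) (i ≟ᶠ j) only (λ { refl → pⱼ }))) (count-≡ j)

injection≤count : {P : Pred (Fin n) p} (P? : Decidable P) (h : Fin k → Fin n) →
                  (∀ {i j} → h i ≡ h j → i ≡ j) → (∀ j → P (h j)) → k ≤ count P?
injection≤count {n} {k = k} {P = P} P? h h-injective P∘h = begin
  k                                   ≡⟨ *-identityʳ k ⟨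
  k * 1                               ≡⟨ sum-const k 1 ⟨
  ∑[ j < k ] 1                        ≡⟨ sum-cong-≗ (λ j → count-≡ (h j)) ⟨
  ∑[ j < k ] ∑[ i < n ] 𝟙 (i ≟ᶠ h j)  ≡⟨ ∑-comm (λ j i → 𝟙 (i ≟ᶠ h j)) ⟩
  ∑[ i < n ] count (λ j → i ≟ᶠ h j)   ≤⟨ sum-mono-≤ _ _ fibre≤𝟙 ⟩
  count P?                            ∎
  where
  open ≤-Reasoning
  fibre≤𝟙 : ∀ i → count (λ j → i ≟ᶠ h j) ≤ 𝟙 (P? i)
  fibre≤𝟙 i with P? i
  ... | yes _  = count≤1 (λ j → i ≟ᶠ h j) (λ i≡hⱼ i≡hⱼ′ → h-injective (trans (sym i≡hⱼ) i≡hⱼ′))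
  ... | no ¬pᵢ =
    ≤-reflexive (count-none (λ j → i ≟ᶠ h j) (λ j i≡hⱼ → ¬pᵢ (subst P (sym i≡hⱼ) (P∘h j))))

length-filter-applyUpTo : {P : Pred A p} (P? : Decidable P) (f : ℕ → A) (n : ℕ) →
                          length (filter P? (applyUpTo f n)) ≡ ∑[ i < n ] 𝟙 (P? (f (toℕ i)))
length-filter-applyUpTo P? f zero    = refl
length-filter-applyUpTo P? f (suc n) with P? (f 0)
... | yes _ = cong suc (length-filter-applyUpTo P? (f ∘ suc) n)
... | no  _ = length-filter-applyUpTo P? (f ∘ suc) n

length-filter-cartesianProduct : {P : Pred (A × B) p} (P? : Decidable P) (f : ℕ → A) (m : ℕ) (ys : List B) →
  length (filter P? (cartesianProduct (applyUpTo f m) ys)) ≡ ∑[ i < m ] length (filter P? (map (f (toℕ i) ,_) ys))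
length-filter-cartesianProduct P? f zero    ys = refl
length-filter-cartesianProduct P? f (suc m) ys = begin
  length (filter P? (row ++ rest))               ≡⟨ cong length (filter-++ P? row rest) ⟩
  length (filter P? row ++ filter P? rest)       ≡⟨ length-++ (filter P? row) ⟩
  length (filter P? row) + length (filter P? rest)
    ≡⟨ cong (length (filter P? row) +_) (length-filter-cartesianProduct P? (f ∘ suc) m ys) ⟩
  ∑[ i < suc m ] length (filter P? (map (f (toℕ i) ,_) ys)) ∎
  where
  open ≡-Reasoning
  row = map (f 0 ,_) ys
  rest = cartesianProduct (applyUpTo (f ∘ suc) m) ys

length-filter-grid : {P : Pred (ℕ × ℕ) p} (P? : Decidable P) (m n : ℕ) →
  length (filter P? (cartesianProduct (upTo m) (upTo n))) ≡ ∑[ x < m ] ∑[ y < n ] 𝟙 (P? (toℕ x , toℕ y))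
length-filter-grid P? m n = trans (length-filter-cartesianProduct P? id m (upTo n)) (sum-cong-≗ {m} (λ x →
  trans (cong (length ∘ filter P?) (map-upTo (toℕ x ,_) n)) (length-filter-applyUpTo P? (toℕ x ,_) n)))

^-distribʳ-* : ∀ a b n → (a * b) ^ n ≡ a ^ n * b ^ n
^-distribʳ-* a b zero    = refl
^-distribʳ-* a b (suc n) = trans (cong (a * b *_) (^-distribʳ-* a b n))
  (solve 4 (λ a b x y → a :* b :* (x :* y) := a :* x :* (b :* y)) refl a b (a ^ n) (b ^ n))

^-^-comm : ∀ a m n → (a ^ m) ^ n ≡ (a ^ n) ^ m
^-^-comm a m n = trans (^-*-assoc a m n) (trans (cong (a ^_) (*-comm m n)) (sym (^-*-assoc a n m)))

prime∤⇒coprime : ∀ {p} → Prime p → ¬ p ∣ n → Coprime p n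
prime∤⇒coprime p-prime p∤n (d∣p , d∣n) with prime⇒irreducible p-prime d∣p
... | inj₁ d≡1 = d≡1
... | inj₂ refl = contradiction d∣n p∤n

module ℕProduct = CommutativeMonoidSum *-1-commutativeMonoid
open ℕProduct using () renaming (sum to ∏)

_^sgn_ : ℕ → ℕ → ℕ
c ^sgn zero  = 1
c ^sgn suc _ = c

∏-const : ∀ n c → ∏ {n} (λ _ → c) ≡ c ^ n
∏-const zero    c = refl
∏-const (suc n) c = cong (c *_) (∏-const n c)

∏-^sgn : ∀ n c → ∏ {n} (λ i → c ^sgn toℕ i) ≡ c ^ (n ∸ 1)
∏-^sgn zero    c = refl
∏-^sgn (suc n) c = trans (*-identityˡ _) (∏-const n c)

geometric : ℕ → ℕ → ℕ
geometric c n = ∑[ j < n ] (c ^ toℕ j)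

geometric-step : ∀ c n → 1 + c * geometric c n ≡ geometric c n + c ^ n
geometric-step c n = begin
  1 + c * geometric c n                     ≡⟨ cong (1 +_) (*-distribˡ-sum {n} c (λ j → c ^ toℕ j)) ⟩
  geometric c (suc n)                       ≡⟨ sum-init-last {n} (λ j → c ^ toℕ j) ⟩
  ∑[ j < n ] (c ^ toℕ (inject₁ j)) + c ^ toℕ (fromℕ n)
    ≡⟨ cong₂ _+_ (sum-cong-≗ {n} (λ j → cong (c ^_) (toℕ-inject₁ j))) (cong (c ^_) (toℕ-fromℕ n)) ⟩
  geometric c n + c ^ n                     ∎
  where open ≡-Reasoning

geometric-1 : ∀ n → geometric 1 n ≡ n
geometric-1 n = trans (sum-cong-≗ {n} (λ j → ^-zeroˡ (toℕ j))) (trans (sum-const n 1) (*-identityʳ n))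

geometric-regroup : ∀ κ ζ n →
  ∑[ k < n ] geometric (κ * ζ ^ toℕ k) n ≡ ∑[ j < n ] (κ ^ toℕ j * geometric (ζ ^ toℕ j) n)
geometric-regroup κ ζ n = trans (∑-comm {n} {n} (λ k j → (κ * ζ ^ toℕ k) ^ toℕ j)) (sum-cong-≗ {n} (λ j →
  trans (sum-cong-≗ {n} (λ k → term k j))
        (sym (*-distribˡ-sum {n} (κ ^ toℕ j) (λ k → (ζ ^ toℕ j) ^ toℕ k)))))
  where
  term : ∀ k j → (κ * ζ ^ toℕ k) ^ toℕ j ≡ κ ^ toℕ j * (ζ ^ toℕ j) ^ toℕ k
  term k j = trans (^-distribʳ-* κ (ζ ^ toℕ k) (toℕ j)) (cong (κ ^ toℕ j *_) (^-^-comm ζ (toℕ k) (toℕ j)))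

module Residues (q : ℕ) (q-prime : Prime q) where

  instance
    q≢0 : NonZero q
    q≢0 = prime⇒nonZero q-prime

  ≈-setoid : Setoid 0ℓ 0ℓ
  ≈-setoid = On.setoid (setoid ℕ) (_% q)

  open Setoid ≈-setoid public
    using (_≈_; _≉_) renaming (refl to ≈-refl; sym to ≈-sym; trans to ≈-trans)
  module ≈-Reasoning = SetoidReasoning ≈-setoid

  infix 4 _≈?_
  _≈?_ : (a b : ℕ) → Dec (a ≈ b)
  a ≈? b = a % q ≟ b % q

  ≡⇒≈ : ∀ {a b} → a ≡ b → a ≈ b
  ≡⇒≈ = cong (_% q)

  %-≈ : ∀ a → a % q ≈ a
  %-≈ a = m%n%n≡m%n a q

  +-cong : ∀ {a b c d} → a ≈ b → c ≈ d → a + c ≈ b + d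
  +-cong {a} {b} {c} {d} a≈b c≈d = begin
    (a + c) % q              ≡⟨ %-distribˡ-+ a c q ⟩
    (a % q + c % q) % q      ≡⟨ cong₂ (λ x y → (x + y) % q) a≈b c≈d ⟩
    (b % q + d % q) % q      ≡⟨ %-distribˡ-+ b d q ⟨
    (b + d) % q              ∎
    where open ≡-Reasoning

  *-cong : ∀ {a b c d} → a ≈ b → c ≈ d → a * c ≈ b * d
  *-cong {a} {b} {c} {d} a≈b c≈d = begin
    (a * c) % q              ≡⟨ %-distribˡ-* a c q ⟩
    (a % q * (c % q)) % q    ≡⟨ cong₂ (λ x y → (x * y) % q) a≈b c≈d ⟩
    (b % q * (d % q)) % q    ≡⟨ %-distribˡ-* b d q ⟨
    (b * d) % q              ∎
    where open ≡-Reasoning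

  ^-cong : ∀ {a b} → a ≈ b → ∀ n → a ^ n ≈ b ^ n
  ^-cong a≈b zero    = ≈-refl
  ^-cong a≈b (suc n) = *-cong a≈b (^-cong a≈b n)

  0%q≡0 : 0 % q ≡ 0
  0%q≡0 = m<n⇒m%n≡m (>-nonZero⁻¹ q)

  ∣⇒≈0 : ∀ {a} → q ∣ a → a ≈ 0
  ∣⇒≈0 {a} q∣a = trans (n∣m⇒m%n≡0 a q q∣a) (sym 0%q≡0)

  ≈0⇒∣ : ∀ {a} → a ≈ 0 → q ∣ a
  ≈0⇒∣ {a} a≈0 = m%n≡0⇒n∣m a q (trans a≈0 0%q≡0)

  0<n<q⇒≉0 : 0 < n → n < q → n ≉ 0
  0<n<q⇒≉0 {suc n} _ n<q n≈0 = <⇒≱ n<q (∣⇒≤ (≈0⇒∣ n≈0))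

  1<q : 1 < q
  1<q = nonTrivial⇒n>1 q {{prime⇒nonTrivial q-prime}}

  1≉0 : 1 ≉ 0
  1≉0 = 0<n<q⇒≉0 z<s 1<q

  +1≈0⇒²≈1 : ∀ {u} → u + 1 ≈ 0 → u * u ≈ 1
  +1≈0⇒²≈1 {u} u+1≈0 = begin
    u * u               ≡⟨ +-identityʳ (u * u) ⟨
    u * u + 0           ≈⟨ +-cong (≈-refl {u * u}) u+1≈0 ⟨
    u * u + (u + 1)     ≡⟨ solve 1 (λ u → u :* u :+ (u :+ con 1) := u :* (u :+ con 1) :+ con 1) refl u ⟩
    u * (u + 1) + 1     ≈⟨ +-cong (*-cong (≈-refl {u}) u+1≈0) (≈-refl {1}) ⟩
    u * 0 + 1           ≡⟨ cong (_+ 1) (*-zeroʳ u) ⟩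
    1                   ∎
    where open ≈-Reasoning

  inverse : ∀ {a} → a ≉ 0 → ∃[ b ] a * b ≈ 1
  inverse {a} a≉0 with coprime-Bézout (prime∤⇒coprime q-prime (a≉0 ∘ ∣⇒≈0))
  ... | Bézout.-+ x y 1+xq≡ya = y , (begin
    a * y          ≡⟨ *-comm a y ⟩
    y * a          ≡⟨ 1+xq≡ya ⟨
    1 + x * q      ≈⟨ %-remove-+ʳ 1 {x * q} (divides x refl) ⟩
    1              ∎)
    where open ≈-Reasoning
  ... | Bézout.+- x y 1+ya≡xq = y * (y * a) , (begin
    a * (y * (y * a))  ≡⟨ solve 2 (λ a y → a :* (y :* (y :* a)) := (y :* a) :* (y :* a)) refl a y ⟩
    y * a * (y * a)    ≈⟨ +1≈0⇒²≈1 ya+1≈0 ⟩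
    1                  ∎)
    where
    open ≈-Reasoning
    ya+1≈0 : y * a + 1 ≈ 0
    ya+1≈0 = ≈-trans (≡⇒≈ (trans (+-comm (y * a) 1) 1+ya≡xq)) (∣⇒≈0 (divides x refl))

  *-cancelʳ-≈ : ∀ {a b c} → c ≉ 0 → a * c ≈ b * c → a ≈ b
  *-cancelʳ-≈ {a} {b} {c} c≉0 ac≈bc = begin
    a                ≡⟨ *-identityʳ a ⟨
    a * 1            ≈⟨ *-cong (≈-refl {a}) c*c⁻¹≈1 ⟨
    a * (c * c⁻¹)    ≡⟨ *-assoc a c c⁻¹ ⟨
    a * c * c⁻¹      ≈⟨ *-cong ac≈bc (≈-refl {c⁻¹}) ⟩
    b * c * c⁻¹      ≡⟨ *-assoc b c c⁻¹ ⟩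
    b * (c * c⁻¹)    ≈⟨ *-cong (≈-refl {b}) c*c⁻¹≈1 ⟩
    b * 1            ≡⟨ *-identityʳ b ⟩
    b                ∎
    where
    open ≈-Reasoning
    c⁻¹ = proj₁ (inverse c≉0)
    c*c⁻¹≈1 = proj₂ (inverse c≉0)

  *-≉0 : ∀ {a b} → a ≉ 0 → b ≉ 0 → a * b ≉ 0
  *-≉0 {a} {b} a≉0 b≉0 ab≈0 = b≉0 (*-cancelʳ-≈ a≉0 (≈-trans (≡⇒≈ (*-comm b a)) ab≈0))

  ^-≉0 : ∀ {a} → a ≉ 0 → ∀ n → a ^ n ≉ 0
  ^-≉0 a≉0 zero    = 1≉0
  ^-≉0 a≉0 (suc n) = *-≉0 a≉0 (^-≉0 a≉0 n)

  ≈0⇒^≈0 : ∀ {a} → 0 < n → a ≈ 0 → a ^ n ≈ 0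
  ≈0⇒^≈0 {suc n} {a} _ a≈0 = *-cong a≈0 (≈-refl {a ^ n})

  ^≈1⇒≉0 : ∀ {c} → 0 < n → c ^ n ≈ 1 → c ≉ 0
  ^≈1⇒≉0 n>0 cⁿ≈1 c≈0 = 1≉0 (≈-trans (≈-sym cⁿ≈1) (≈0⇒^≈0 n>0 c≈0))

  inverse-unique : ∀ {a b c} → a * b ≈ 1 → a * c ≈ 1 → b ≈ c
  inverse-unique {a} {b} {c} ab≈1 ac≈1 = *-cancelʳ-≈ a≉0
    (≈-trans (≡⇒≈ (*-comm b a)) (≈-trans ab≈1 (≈-trans (≈-sym ac≈1) (≡⇒≈ (*-comm a c)))))
    where
    a≉0 : a ≉ 0
    a≉0 a≈0 = 1≉0 (≈-trans (≈-sym ab≈1) (*-cong a≈0 (≈-refl {b})))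

  ^-*≈1 : ∀ {c} → c ^ n ≈ 1 → ∀ k → c ^ (k * n) ≈ 1
  ^-*≈1 {n} {c} cⁿ≈1 k = begin
    c ^ (k * n)     ≡⟨ cong (c ^_) (*-comm k n) ⟩
    c ^ (n * k)     ≡⟨ ^-*-assoc c n k ⟨
    (c ^ n) ^ k     ≈⟨ ^-cong cⁿ≈1 k ⟩
    1 ^ k           ≡⟨ ^-zeroˡ k ⟩
    1               ∎
    where open ≈-Reasoning

  ^-1+*≈ : ∀ {c} → c ^ n ≈ 1 → ∀ k → c ^ (1 + k * n) ≈ c
  ^-1+*≈ {n} {c} cⁿ≈1 k = ≈-trans (*-cong (≈-refl {c}) (^-*≈1 cⁿ≈1 k)) (≡⇒≈ (*-identityʳ c))

  root-power : ∀ {c} → c ^ n ≈ 1 → ∀ k → (c ^ k) ^ n ≈ 1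
  root-power {n} {c} cⁿ≈1 k = ≈-trans (≡⇒≈ (^-*-assoc c k n)) (^-*≈1 cⁿ≈1 k)

  root-* : ∀ {a b} → a ^ n ≈ 1 → b ^ n ≈ 1 → (a * b) ^ n ≈ 1
  root-* {n} {a} {b} aⁿ≈1 bⁿ≈1 = ≈-trans (≡⇒≈ (^-distribʳ-* a b n)) (*-cong aⁿ≈1 bⁿ≈1)

  coprime-orders⇒≈1 : ∀ {c d e} → Coprime d e → c ^ d ≈ 1 → c ^ e ≈ 1 → c ≈ 1
  coprime-orders⇒≈1 {c} d⊥e cᵈ≈1 cᵉ≈1 with coprime-Bézout d⊥e
  ... | Bézout.+- x y 1+ye≡xd =
    ≈-trans (≈-sym (^-1+*≈ cᵉ≈1 y)) (≈-trans (≡⇒≈ (cong (c ^_) 1+ye≡xd)) (^-*≈1 cᵈ≈1 x))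
  ... | Bézout.-+ x y 1+xd≡ye =
    ≈-trans (≈-sym (^-1+*≈ cᵈ≈1 x)) (≈-trans (≡⇒≈ (cong (c ^_) 1+xd≡ye)) (^-*≈1 cᵉ≈1 y))

  coprime-exponent-root : ∀ {b m} → Coprime n m → b ≉ 0 → b ^ m ≈ 1 → ∃[ w ] w ^ n ≈ b
  coprime-exponent-root {n} {b} {m} n⊥m b≉0 bᵐ≈1 with coprime-Bézout n⊥m
  ... | Bézout.+- x y 1+ym≡xn = b ^ x , (begin
    (b ^ x) ^ n      ≡⟨ ^-*-assoc b x n ⟩
    b ^ (x * n)      ≡⟨ cong (b ^_) 1+ym≡xn ⟨
    b ^ (1 + y * m)  ≈⟨ ^-1+*≈ bᵐ≈1 y ⟩
    b                ∎)
    where open ≈-Reasoning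
  ... | Bézout.-+ x y 1+xn≡ym = u⁻¹ , ≈-sym (inverse-unique {u ^ n} uⁿ*b≈1 uⁿ*u⁻ⁿ≈1)
    where
    u = b ^ x
    u⁻¹ = proj₁ (inverse (^-≉0 b≉0 x))
    uⁿ*u⁻ⁿ≈1 : u ^ n * u⁻¹ ^ n ≈ 1
    uⁿ*u⁻ⁿ≈1 = ≈-trans (≡⇒≈ (sym (^-distribʳ-* u u⁻¹ n)))
                 (≈-trans (^-cong (proj₂ (inverse (^-≉0 b≉0 x))) n) (≡⇒≈ (^-zeroˡ n)))
    uⁿ*b≈1 : u ^ n * b ≈ 1
    uⁿ*b≈1 = begin
      u ^ n * b        ≡⟨ *-comm (u ^ n) b ⟩
      b * u ^ n        ≡⟨ cong (b *_) (^-*-assoc b x n) ⟩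
      b ^ (1 + x * n)  ≡⟨ cong (b ^_) 1+xn≡ym ⟩
      b ^ (y * m)      ≈⟨ ^-*≈1 bᵐ≈1 y ⟩
      1                ∎
      where open ≈-Reasoning

  +-inverse : ∀ c → c + (q ∸ 1) * c ≈ 0
  +-inverse c = ≈-trans (≡⇒≈ (cong (_* c) (m+[n∸m]≡n (>-nonZero⁻¹ q)))) (∣⇒≈0 (m∣m*n c))

  +-cancelʳ-≈ : ∀ {a b c} → a + c ≈ b + c → a ≈ b
  +-cancelʳ-≈ {a} {b} {c} a+c≈b+c = begin
    a                        ≡⟨ +-identityʳ a ⟨
    a + 0                    ≈⟨ +-cong (≈-refl {a}) (+-inverse c) ⟨
    a + (c + (q ∸ 1) * c)    ≡⟨ +-assoc a c _ ⟨
    a + c + (q ∸ 1) * c      ≈⟨ +-cong a+c≈b+c (≈-refl {(q ∸ 1) * c}) ⟩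
    b + c + (q ∸ 1) * c      ≡⟨ +-assoc b c _ ⟩
    b + (c + (q ∸ 1) * c)    ≈⟨ +-cong (≈-refl {b}) (+-inverse c) ⟩
    b + 0                    ≡⟨ +-identityʳ b ⟩
    b                        ∎
    where open ≈-Reasoning

  ∑-≈0 : (f : Fin n → ℕ) → (∀ i → f i ≈ 0) → sum f ≈ 0
  ∑-≈0 {zero}  f f≈0 = ≈-refl
  ∑-≈0 {suc n} f f≈0 = +-cong (f≈0 zero) (∑-≈0 (f ∘ suc) (f≈0 ∘ suc))

  ∏-cong-≈ : (f g : Fin n → ℕ) → (∀ i → f i ≈ g i) → ∏ f ≈ ∏ g
  ∏-cong-≈ {zero}  f g f≈g = ≈-refl
  ∏-cong-≈ {suc n} f g f≈g = *-cong (f≈g zero) (∏-cong-≈ (f ∘ suc) (g ∘ suc) (f≈g ∘ suc))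

  ∏-≉0 : (f : Fin n → ℕ) → (∀ i → f i ≉ 0) → ∏ f ≉ 0
  ∏-≉0 {zero}  f f≉0 = 1≉0
  ∏-≉0 {suc n} f f≉0 = *-≉0 (f≉0 zero) (∏-≉0 (f ∘ suc) (f≉0 ∘ suc))

  toℕ-mod : ∀ a → toℕ (a mod q) ≈ a
  toℕ-mod a = trans (cong (_% q) (toℕ-fromℕ< (m%n<n a q))) (%-≈ a)

  toℕ-≈⇒≡ : ∀ {x y : Fin q} → toℕ x ≈ toℕ y → x ≡ y
  toℕ-≈⇒≡ {x} {y} x≈y =
    toℕ-injective (trans (sym (m<n⇒m%n≡m (toℕ<n x))) (trans x≈y (m<n⇒m%n≡m (toℕ<n y))))

  scale : ℕ → Fin q → Fin q
  scale c x = (c * toℕ x) mod q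

  scale-inverse : ∀ {c d} → c * d ≈ 1 → ∀ x → scale c (scale d x) ≡ x
  scale-inverse {c} {d} cd≈1 x = toℕ-≈⇒≡ (begin
    toℕ (scale c (scale d x))   ≈⟨ toℕ-mod _ ⟩
    c * toℕ (scale d x)         ≈⟨ *-cong (≈-refl {c}) (toℕ-mod _) ⟩
    c * (d * toℕ x)             ≡⟨ *-assoc c d _ ⟨
    c * d * toℕ x               ≈⟨ *-cong cd≈1 (≈-refl {toℕ x}) ⟩
    1 * toℕ x                   ≡⟨ *-identityˡ _ ⟩
    toℕ x                       ∎)
    where open ≈-Reasoning

  scaling : ∀ {c} → c ≉ 0 → Permutation q q
  scaling {c} c≉0 = permutation (scale c) (scale c⁻¹)
    (scale-inverse {c} {c⁻¹} c*c⁻¹≈1)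
    (scale-inverse {c⁻¹} {c} (≈-trans (≡⇒≈ (*-comm c⁻¹ c)) c*c⁻¹≈1))
    where
    c⁻¹ = proj₁ (inverse c≉0)
    c*c⁻¹≈1 = proj₂ (inverse c≉0)

  sum-scale : ∀ {c} → c ≉ 0 → (g : ℕ → ℕ) → g Preserves _≈_ ⟶ _≡_ →
              ∑[ x < q ] g (c * toℕ x) ≡ ∑[ x < q ] g (toℕ x)
  sum-scale {c} c≉0 g g-cong = sym (trans (sum-permute (g ∘ toℕ) (scaling c≉0))
                                          (sum-cong-≗ {q} (λ x → g-cong (toℕ-mod (c * toℕ x)))))

  ⊔1-scale : ∀ {c} → c ≉ 0 → n < q → (c * n) % q ⊔ 1 ≈ c ^sgn n * (n ⊔ 1)
  ⊔1-scale {zero}  {c} c≉0 _   =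
    ≡⇒≈ (trans (cong (λ z → z % q ⊔ 1) (*-zeroʳ c)) (cong (_⊔ 1) 0%q≡0))
  ⊔1-scale {suc k} {c} c≉0 n<q = begin
    (c * suc k) % q ⊔ 1    ≡⟨ m≥n⇒m⊔n≡m (n≢0⇒n>0 cn%q≢0) ⟩
    (c * suc k) % q        ≈⟨ %-≈ (c * suc k) ⟩
    c * suc k              ≡⟨ cong (λ z → c * suc z) (⊔-identityʳ k) ⟨
    c * (suc k ⊔ 1)        ∎
    where
    open ≈-Reasoning
    cn%q≢0 : (c * suc k) % q ≢ 0
    cn%q≢0 cn%q≡0 = *-≉0 c≉0 (0<n<q⇒≉0 z<s n<q) (trans cn%q≡0 (sym 0%q≡0))

  -- Over the residues x < q, the product of x ⊔ 1 (x with 0 replaced by 1) is a unit; scaling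
  -- by c permutes the residues and multiplies each factor with x ≠ 0 by c.
  fermat : ∀ {c} → c ≉ 0 → c ^ (q ∸ 1) ≈ 1
  fermat {c} c≉0 = *-cancelʳ-≈ (∏-≉0 u u≉0) (begin
    c ^ (q ∸ 1) * ∏ u                   ≡⟨ cong (_* ∏ u) (∏-^sgn q c) ⟨
    ∏ {q} (λ x → c ^sgn toℕ x) * ∏ u    ≡⟨ ℕProduct.∑-distrib-+ {q} (λ x → c ^sgn toℕ x) u ⟨
    ∏ {q} (λ x → c ^sgn toℕ x * u x)    ≈⟨ ∏-cong-≈ {q} _ _ scaled-unit ⟨
    ∏ (u ∘ scale c)                     ≡⟨ ℕProduct.sum-permute u (scaling c≉0) ⟨
    ∏ u                                 ≡⟨ *-identityˡ (∏ u) ⟨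
    1 * ∏ u                             ∎)
    where
    open ≈-Reasoning
    u : Fin q → ℕ
    u x = toℕ x ⊔ 1
    u≉0 : ∀ x → u x ≉ 0
    u≉0 x = 0<n<q⇒≉0 (m≤n⊔m (toℕ x) 1) (⊔-pres-<m (toℕ<n x) 1<q)
    scaled-unit : ∀ x → u (scale c x) ≈ c ^sgn toℕ x * u x
    scaled-unit x = ≈-trans (≡⇒≈ (cong (_⊔ 1) (toℕ-fromℕ< (m%n<n (c * toℕ x) q)))) (⊔1-scale c≉0 (toℕ<n x))

  geometric≈0 : ∀ {c} → c ^ n ≈ 1 → c ≉ 1 → geometric c n ≈ 0
  geometric≈0 {n} {c} cⁿ≈1 c≉1 with geometric c n ≈? 0
  ... | yes G≈0 = G≈0
  ... | no  G≉0 = contradiction (*-cancelʳ-≈ G≉0 cG≈1G) c≉1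
    where
    G = geometric c n
    cG≈1G : c * G ≈ 1 * G
    cG≈1G = +-cancelʳ-≈ {c = 1} (begin
      c * G + 1     ≡⟨ +-comm (c * G) 1 ⟩
      1 + c * G     ≡⟨ geometric-step c n ⟩
      G + c ^ n     ≈⟨ +-cong (≈-refl {G}) cⁿ≈1 ⟩
      G + 1         ≡⟨ cong (_+ 1) (*-identityˡ G) ⟨
      1 * G + 1     ∎)
      where open ≈-Reasoning

  IsPrimitiveRoot : ℕ → ℕ → Set
  IsPrimitiveRoot n ζ = ζ ^ n ≈ 1 × (∀ {j} → 0 < j → j < n → ζ ^ j ≉ 1)

  prime⇒primitive : ∀ {ℓ ζ} → Prime ℓ → ζ ^ ℓ ≈ 1 → ζ ≉ 1 → IsPrimitiveRoot ℓ ζ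
  prime⇒primitive {ℓ} {ζ} ℓ-prime ζˡ≈1 ζ≉1 = ζˡ≈1 , ζʲ≉1
    where
    ζʲ≉1 : ∀ {j} → 0 < j → j < ℓ → ζ ^ j ≉ 1
    ζʲ≉1 {suc j} _ j<ℓ ζʲ≈1 = ζ≉1 (coprime-orders⇒≈1 (prime⇒coprime ℓ-prime j<ℓ) ζˡ≈1 ζʲ≈1)

  ^≈^⇒^∸≈1 : ∀ {ζ i j} → ζ ≉ 0 → i ≤ j → ζ ^ i ≈ ζ ^ j → ζ ^ (j ∸ i) ≈ 1
  ^≈^⇒^∸≈1 {ζ} {i} {j} ζ≉0 i≤j ζⁱ≈ζʲ = *-cancelʳ-≈ (^-≉0 ζ≉0 i) (begin
    ζ ^ (j ∸ i) * ζ ^ i    ≡⟨ ^-distribˡ-+-* ζ (j ∸ i) i ⟨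
    ζ ^ (j ∸ i + i)        ≡⟨ cong (ζ ^_) (m∸n+n≡m i≤j) ⟩
    ζ ^ j                  ≈⟨ ζⁱ≈ζʲ ⟨
    ζ ^ i                  ≡⟨ *-identityˡ (ζ ^ i) ⟨
    1 * ζ ^ i              ∎)
    where open ≈-Reasoning

  primitive-powers-distinct : ∀ {ζ i j} → IsPrimitiveRoot n ζ → i < j → j < n → ζ ^ i ≉ ζ ^ j
  primitive-powers-distinct {i = i} {j} (ζⁿ≈1 , ζʲ≉1) i<j j<n ζⁱ≈ζʲ =
    ζʲ≉1 (m<n⇒0<n∸m i<j) (≤-<-trans (m∸n≤m j i) j<n)
      (^≈^⇒^∸≈1 (^≈1⇒≉0 (≤-<-trans z≤n j<n) ζⁿ≈1) (<⇒≤ i<j) ζⁱ≈ζʲ)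

  primitive-powers-injective : ∀ {ζ i j} → IsPrimitiveRoot n ζ → i < n → j < n → ζ ^ i ≈ ζ ^ j → i ≡ j
  primitive-powers-injective {i = i} {j} ζ-primitive i<n j<n ζⁱ≈ζʲ with <-cmp i j
  ... | tri< i<j _ _ = contradiction ζⁱ≈ζʲ (primitive-powers-distinct ζ-primitive i<j j<n)
  ... | tri≈ _ i≡j _ = i≡j
  ... | tri> _ _ j<i = contradiction (≈-sym ζⁱ≈ζʲ) (primitive-powers-distinct ζ-primitive j<i i<n)

  -- If no κ ζ^k were 1, the double sum ∑_k ∑_j (κ ζ^k)^j would vanish termwise, whereas
  -- regrouped as ∑_j κ^j ∑_k (ζ^j)^k only its j = 0 term survives, giving n.
  primitive-root-generates : ∀ {ζ κ} → IsPrimitiveRoot n ζ → n ≉ 0 → κ ^ n ≈ 1 →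
                             ∃[ k ] k < n × κ * ζ ^ k ≈ 1
  primitive-root-generates {zero} _ 0≉0 _ = contradiction ≈-refl 0≉0
  primitive-root-generates {n@(suc n-1)} {ζ} {κ} (ζⁿ≈1 , ζʲ≉1) n≉0 κⁿ≈1
    with any? (λ (k : Fin n) → κ * ζ ^ toℕ k ≈? 1)
  ... | yes (k , κζᵏ≈1) = toℕ k , toℕ<n k , κζᵏ≈1
  ... | no ∄k = contradiction (begin
    n                                                   ≡⟨ j=0-term ⟨
    1 * geometric 1 n + 0                               ≈⟨ +-cong (≈-refl {1 * geometric 1 n}) j>0-terms ⟨
    ∑[ j < n ] (κ ^ toℕ j * geometric (ζ ^ toℕ j) n)    ≡⟨ geometric-regroup κ ζ n ⟨
    ∑[ k < n ] geometric (κ * ζ ^ toℕ k) n              ≈⟨ ∑-≈0 _ k-term≈0 ⟩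
    0                                                   ∎) n≉0
    where
    open ≈-Reasoning
    j=0-term : 1 * geometric 1 n + 0 ≡ n
    j=0-term = trans (+-identityʳ _) (trans (*-identityˡ _) (geometric-1 n))
    j>0-term≈0 : ∀ (j : Fin n-1) → κ ^ suc (toℕ j) * geometric (ζ ^ suc (toℕ j)) n ≈ 0
    j>0-term≈0 j = ≈-trans (*-cong (≈-refl {κ ^ suc (toℕ j)}) geometric≈0′) (≡⇒≈ (*-zeroʳ (κ ^ suc (toℕ j))))
      where
      geometric≈0′ : geometric (ζ ^ suc (toℕ j)) n ≈ 0
      geometric≈0′ = geometric≈0 {n} (root-power {n} {ζ} ζⁿ≈1 (suc (toℕ j))) (ζʲ≉1 z<s (s≤s (toℕ<n j)))
    j>0-terms : ∑[ j < n-1 ] (κ ^ suc (toℕ j) * geometric (ζ ^ suc (toℕ j)) n) ≈ 0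
    j>0-terms = ∑-≈0 _ j>0-term≈0
    k-term≈0 : ∀ (k : Fin n) → geometric (κ * ζ ^ toℕ k) n ≈ 0
    k-term≈0 k = geometric≈0 {n} (root-* {n} {κ} κⁿ≈1 (root-power {n} {ζ} ζⁿ≈1 (toℕ k))) (λ e → ∄k (k , e))

  roots : ℕ → ℕ → ℕ
  roots n b = count {q} (λ y → toℕ y ^ n ≈? b)

  roots-cong : ∀ n → roots n Preserves _≈_ ⟶ _≡_
  roots-cong n {b} {b′} b≈b′ = sum-cong-≗ {q} (λ y →
    𝟙-cong (toℕ y ^ n ≈? b) (toℕ y ^ n ≈? b′) (λ e → ≈-trans e b≈b′) (λ e → ≈-trans e (≈-sym b≈b′)))

  1≤roots : ∀ {y b} → y ^ n ≈ b → 1 ≤ roots n b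
  1≤roots {n} {y} {b} yⁿ≈b =
    1≤count (λ y → toℕ y ^ n ≈? b) {y mod q} (≈-trans (^-cong (toℕ-mod y) n) yⁿ≈b)

  primitive⇒n≤roots : ∀ {η w b} → IsPrimitiveRoot n η → w ≉ 0 → w ^ n ≈ b → n ≤ roots n b
  primitive⇒n≤roots {n} {η} {w} {b} η-primitive w≉0 wⁿ≈b =
    injection≤count (λ y → toℕ y ^ n ≈? b) h h-injective h-root
    where
    h : Fin n → Fin q
    h j = (w * η ^ toℕ j) mod q
    h-root : ∀ j → toℕ (h j) ^ n ≈ b
    h-root j = begin
      toℕ (h j) ^ n             ≈⟨ ^-cong (toℕ-mod _) n ⟩
      (w * η ^ toℕ j) ^ n       ≡⟨ ^-distribʳ-* w _ n ⟩
      w ^ n * (η ^ toℕ j) ^ n   ≈⟨ *-cong wⁿ≈b (root-power {n} {η} (proj₁ η-primitive) (toℕ j)) ⟩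
      b * 1                     ≡⟨ *-identityʳ b ⟩
      b                         ∎
      where open ≈-Reasoning
    h-injective : ∀ {i j} → h i ≡ h j → i ≡ j
    h-injective {i} {j} hᵢ≡hⱼ = toℕ-injective (primitive-powers-injective η-primitive (toℕ<n i) (toℕ<n j)
      (*-cancelʳ-≈ w≉0 (begin
        η ^ toℕ i * w    ≡⟨ *-comm _ w ⟩
        w * η ^ toℕ i    ≈⟨ toℕ-mod _ ⟨
        toℕ (h i)        ≡⟨ cong toℕ hᵢ≡hⱼ ⟩
        toℕ (h j)        ≈⟨ toℕ-mod _ ⟩
        w * η ^ toℕ j    ≡⟨ *-comm w _ ⟩
        η ^ toℕ j * w    ∎)))
      where open ≈-Reasoning

  ∑-roots : ∀ n → ∑[ a < q ] roots n (toℕ a) ≡ q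
  ∑-roots n = begin
    ∑[ a < q ] ∑[ y < q ] 𝟙 (toℕ y ^ n ≈? toℕ a)    ≡⟨ ∑-comm {q} {q} (λ a y → 𝟙 (toℕ y ^ n ≈? toℕ a)) ⟩
    ∑[ y < q ] count {q} (λ a → toℕ y ^ n ≈? toℕ a)
      ≡⟨ sum-cong-≗ {q} (λ y → count-unique _ _ only (≈-sym (toℕ-mod _))) ⟩
    ∑[ y < q ] 1                                  ≡⟨ sum-const q 1 ⟩
    q * 1                                         ≡⟨ *-identityʳ q ⟩
    q                                             ∎
    where
    open ≡-Reasoning
    only : ∀ {y a} → toℕ y ^ n ≈ toℕ a → a ≡ (toℕ y ^ n) mod q
    only yⁿ≈a = toℕ-≈⇒≡ (≈-trans (≈-sym yⁿ≈a) (≈-sym (toℕ-mod _)))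

module Curve (ℓ q m : ℕ) (ℓ-prime : Prime ℓ) (q-prime : Prime q) (q≢ℓ : q ≢ ℓ)
             (q-1≡mℓ : q ∸ 1 ≡ m * ℓ) (ℓ⊥m : Coprime ℓ m) where

  open Residues q q-prime

  instance
    ℓ≢0 : NonZero ℓ
    ℓ≢0 = prime⇒nonZero ℓ-prime

  ℓ>0 : 0 < ℓ
  ℓ>0 = >-nonZero⁻¹ ℓ

  ℓ≉0 : ℓ ≉ 0
  ℓ≉0 ℓ≈0 with prime⇒irreducible ℓ-prime (≈0⇒∣ ℓ≈0)
  ... | inj₁ q≡1 = <⇒≢ 1<q (sym q≡1)
  ... | inj₂ q≡ℓ = q≢ℓ q≡ℓ

  fermat-root : ∀ {a} → a ≉ 0 → (a ^ m) ^ ℓ ≈ 1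
  fermat-root {a} a≉0 = ≈-trans (≡⇒≈ (trans (^-*-assoc a m ℓ) (cong (a ^_) (sym q-1≡mℓ)))) (fermat a≉0)

  F : ℕ → ℕ
  F x = x * (x ^ ℓ + (q ∸ 1))

  F-cong : F Preserves _≈_ ⟶ _≈_
  F-cong a≈b = *-cong a≈b (+-cong (^-cong a≈b ℓ) (≈-refl {q ∸ 1}))

  F-twist : ∀ {c} x → c ^ ℓ ≈ 1 → F (c * x) ≈ c * F x
  F-twist {c} x cˡ≈1 = begin
    c * x * ((c * x) ^ ℓ + (q ∸ 1))    ≡⟨ cong (λ z → c * x * (z + (q ∸ 1))) (^-distribʳ-* c x ℓ) ⟩
    c * x * (c ^ ℓ * x ^ ℓ + (q ∸ 1))
      ≈⟨ *-cong (≈-refl {c * x}) (+-cong (*-cong cˡ≈1 (≈-refl {x ^ ℓ})) (≈-refl {q ∸ 1})) ⟩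
    c * x * (1 * x ^ ℓ + (q ∸ 1))      ≡⟨ cong (λ z → c * x * (z + (q ∸ 1))) (*-identityˡ (x ^ ℓ)) ⟩
    c * x * (x ^ ℓ + (q ∸ 1))          ≡⟨ *-assoc c x _ ⟩
    c * F x                            ∎
    where open ≈-Reasoning

  #affine : ℕ
  #affine = ∑[ x < q ] roots ℓ (F (toℕ x))

  T : ℕ → ℕ → ℕ
  T η a = ∑[ i < ℓ ] roots ℓ (η ^ toℕ i * a)

  T-cong : ∀ η → T η Preserves _≈_ ⟶ _≡_
  T-cong η a≈b = sum-cong-≗ {ℓ} (λ i → roots-cong ℓ (*-cong (≈-refl {η ^ toℕ i}) a≈b))

  #affine≡∑-twisted : ∀ {c} → c ≉ 0 → c ^ ℓ ≈ 1 → #affine ≡ ∑[ x < q ] roots ℓ (c * F (toℕ x))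
  #affine≡∑-twisted {c} c≉0 cˡ≈1 = trans (sym (sum-scale c≉0 (roots ℓ ∘ F) (roots-cong ℓ ∘ F-cong)))
                                        (sum-cong-≗ {q} (λ x → roots-cong ℓ (F-twist (toℕ x) cˡ≈1)))

  ℓ*#affine≡∑T : ∀ {η} → η ^ ℓ ≈ 1 → ℓ * #affine ≡ ∑[ x < q ] T η (F (toℕ x))
  ℓ*#affine≡∑T {η} ηˡ≈1 = begin
    ℓ * #affine                                              ≡⟨ sum-const ℓ #affine ⟨
    ∑[ i < ℓ ] #affine                                       ≡⟨ sum-cong-≗ {ℓ} twist ⟩
    ∑[ i < ℓ ] ∑[ x < q ] roots ℓ (η ^ toℕ i * F (toℕ x))    ≡⟨ ∑-comm {ℓ} {q} _ ⟩
    ∑[ x < q ] T η (F (toℕ x))                               ∎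
    where
    open ≡-Reasoning
    twist : ∀ (i : Fin ℓ) → #affine ≡ ∑[ x < q ] roots ℓ (η ^ toℕ i * F (toℕ x))
    twist i = #affine≡∑-twisted (^-≉0 (^≈1⇒≉0 ℓ>0 ηˡ≈1) (toℕ i)) (root-power {ℓ} {η} ηˡ≈1 (toℕ i))

  ∑T≡q*ℓ : ∀ {η} → η ≉ 0 → ∑[ a < q ] T η (toℕ a) ≡ q * ℓ
  ∑T≡q*ℓ {η} η≉0 = begin
    ∑[ a < q ] T η (toℕ a)                                ≡⟨ ∑-comm {q} {ℓ} _ ⟩
    ∑[ i < ℓ ] ∑[ a < q ] roots ℓ (η ^ toℕ i * toℕ a)
      ≡⟨ sum-cong-≗ {ℓ} (λ i → sum-scale (^-≉0 η≉0 (toℕ i)) (roots ℓ) (roots-cong ℓ)) ⟩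
    ∑[ i < ℓ ] ∑[ a < q ] roots ℓ (toℕ a)                 ≡⟨ sum-cong-≗ {ℓ} (λ _ → ∑-roots ℓ) ⟩
    ∑[ i < ℓ ] q                                          ≡⟨ sum-const ℓ q ⟩
    ℓ * q                                                 ≡⟨ *-comm ℓ q ⟩
    q * ℓ                                                 ∎
    where open ≡-Reasoning

  #affine≡q-if-ℓ≤T : ∀ {η} → η ^ ℓ ≈ 1 → (∀ a → ℓ ≤ T η a) → #affine ≡ q
  #affine≡q-if-ℓ≤T {η} ηˡ≈1 ℓ≤T = *-cancelˡ-≡ #affine q ℓ (begin
    ℓ * #affine                   ≡⟨ ℓ*#affine≡∑T ηˡ≈1 ⟩
    ∑[ x < q ] T η (F (toℕ x))    ≡⟨ sum-cong-≗ {q} (λ x → T≡ℓ (F (toℕ x))) ⟩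
    ∑[ x < q ] ℓ                  ≡⟨ sum-const q ℓ ⟩
    q * ℓ                         ≡⟨ *-comm q ℓ ⟩
    ℓ * q                         ∎)
    where
    open ≡-Reasoning
    T≡ℓ : ∀ a → T η a ≡ ℓ
    T≡ℓ a = trans (T-cong η (≈-sym (toℕ-mod a)))
      (sum≡n*c⇒≡c (λ x → T η (toℕ x)) (λ x → ℓ≤T (toℕ x)) (∑T≡q*ℓ (^≈1⇒≉0 ℓ>0 ηˡ≈1)) (a mod q))

  ℓ≤T-if-solvable : ∀ {η a} → (∀ i → ∃[ y ] y ^ ℓ ≈ η ^ i * a) → ℓ ≤ T η a
  ℓ≤T-if-solvable {η} {a} solvable =
    subst (_≤ T η a) (*-identityʳ ℓ) (n*c≤sum {ℓ} (λ i → roots ℓ (η ^ toℕ i * a)) 1≤term)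
    where
    1≤term : ∀ (i : Fin ℓ) → 1 ≤ roots ℓ (η ^ toℕ i * a)
    1≤term i = 1≤roots {ℓ} {proj₁ (solvable (toℕ i))} (proj₂ (solvable (toℕ i)))

  ℓ≤T-at-0 : ∀ {η a} → a ≈ 0 → ℓ ≤ T η a
  ℓ≤T-at-0 {η} {a} a≈0 = ℓ≤T-if-solvable (λ i → 0 , ≈-trans (≈0⇒^≈0 ℓ>0 (≈-refl {0}))
    (≈-sym (≈-trans (*-cong (≈-refl {η ^ i}) a≈0) (≡⇒≈ (*-zeroʳ (η ^ i))))))

  ℓ≤T-primitive : ∀ {η} → η ^ ℓ ≈ 1 → η ^ m ≉ 1 → ∀ a → ℓ ≤ T η a
  ℓ≤T-primitive {η} ηˡ≈1 ηᵐ≉1 a with a ≈? 0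
  ... | yes a≈0 = ℓ≤T-at-0 a≈0
  ... | no  a≉0 = ≤-trans (primitive⇒n≤roots η-primitive w≉0 wˡ≈b)
                    (subst (λ j → roots ℓ (η ^ j * a) ≤ T η a) (toℕ-fromℕ< i<ℓ) (≤-sum _ (fromℕ< i<ℓ)))
    where
    η≉0 = ^≈1⇒≉0 ℓ>0 ηˡ≈1
    η-primitive : IsPrimitiveRoot ℓ η
    η-primitive = prime⇒primitive ℓ-prime ηˡ≈1 (λ η≈1 → ηᵐ≉1 (≈-trans (^-cong η≈1 m) (≡⇒≈ (^-zeroˡ m))))
    ηᵐ-primitive : IsPrimitiveRoot ℓ (η ^ m)
    ηᵐ-primitive = prime⇒primitive ℓ-prime (root-power {ℓ} {η} ηˡ≈1 m) ηᵐ≉1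
    generated = primitive-root-generates ηᵐ-primitive ℓ≉0 (fermat-root a≉0)
    i = proj₁ generated
    i<ℓ = proj₁ (proj₂ generated)
    b = η ^ i * a
    bᵐ≈1 : b ^ m ≈ 1
    bᵐ≈1 = begin
      (η ^ i * a) ^ m        ≡⟨ ^-distribʳ-* (η ^ i) a m ⟩
      (η ^ i) ^ m * a ^ m    ≡⟨ cong (_* a ^ m) (^-^-comm η i m) ⟩
      (η ^ m) ^ i * a ^ m    ≡⟨ *-comm _ (a ^ m) ⟩
      a ^ m * (η ^ m) ^ i    ≈⟨ proj₂ (proj₂ generated) ⟩
      1                      ∎
      where open ≈-Reasoning
    b≉0 = *-≉0 (^-≉0 η≉0 i) a≉0
    root = coprime-exponent-root ℓ⊥m b≉0 bᵐ≈1
    w = proj₁ root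
    wˡ≈b = proj₂ root
    w≉0 : w ≉ 0
    w≉0 w≈0 = b≉0 (≈-trans (≈-sym wˡ≈b) (≈0⇒^≈0 ℓ>0 w≈0))

  ℓ≤T-1 : (∀ ζ → ζ ^ ℓ ≈ 1 → ζ ^ m ≈ 1) → ∀ a → ℓ ≤ T 1 a
  ℓ≤T-1 roots-of-unity-trivial a with a ≈? 0
  ... | yes a≈0 = ℓ≤T-at-0 a≈0
  ... | no  a≉0 = ℓ≤T-if-solvable (λ i → proj₁ root , ≈-trans (proj₂ root) (≡⇒≈ (sym (1ⁱa≡a i))))
    where
    1ⁱa≡a : ∀ i → 1 ^ i * a ≡ a
    1ⁱa≡a i = trans (cong (_* a) (^-zeroˡ i)) (*-identityˡ a)
    aᵐ≈1 : a ^ m ≈ 1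
    aᵐ≈1 = coprime-orders⇒≈1 ℓ⊥m (fermat-root a≉0) (roots-of-unity-trivial (a ^ m) (fermat-root a≉0))
    root = coprime-exponent-root ℓ⊥m a≉0 aᵐ≈1

  -- We do not show that 𝔽_q^× has an element of order ℓ; if it has none, then every nonzero
  -- a is an ℓ-th power and η = 1 works instead.
  #affine≡q : #affine ≡ q
  #affine≡q with any? (λ (e : Fin q) → toℕ e ^ ℓ ≈? 1 ×-dec ¬? (toℕ e ^ m ≈? 1))
  ... | yes (e , eˡ≈1 , eᵐ≉1) = #affine≡q-if-ℓ≤T eˡ≈1 (ℓ≤T-primitive eˡ≈1 eᵐ≉1)
  ... | no  ∄e = #affine≡q-if-ℓ≤T (≡⇒≈ (^-zeroˡ ℓ)) (ℓ≤T-1 roots-of-unity-trivial)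
    where
    roots-of-unity-trivial : ∀ ζ → ζ ^ ℓ ≈ 1 → ζ ^ m ≈ 1
    roots-of-unity-trivial ζ ζˡ≈1 = ≈-trans (^-cong (≈-sym (toℕ-mod ζ)) m)
      (decidable-stable (toℕ (ζ mod q) ^ m ≈? 1) (λ eᵐ≉1 → ∄e (ζ mod q , eˡ≈1 , eᵐ≉1)))
      where
      eˡ≈1 : toℕ (ζ mod q) ^ ℓ ≈ 1
      eˡ≈1 = ≈-trans (^-cong (toℕ-mod ζ) ℓ) ζˡ≈1

lemma2p8 : (ℓ q : ℕ) → Prime ℓ → 3 ≤ ℓ → (qp : Prime q) → q ≢ ℓ →
    ℓ ∣ (q ∸ 1) → ¬ (ℓ * ℓ ∣ (q ∸ 1)) → #C ℓ q qp ≡ q + 1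
lemma2p8 ℓ q ℓ-prime _ q-prime q≢ℓ (divides m q-1≡mℓ) ℓ²∤q-1 = cong (_+ 1) (begin
  length (filter (onAffineCurve? ℓ q) (cartesianProduct (upTo q) (upTo q)))  ≡⟨ length-filter-grid _ q q ⟩
  C.#affine                                                                  ≡⟨ C.#affine≡q ⟩
  q                                                                          ∎)
  where
  open ≡-Reasoning
  instance
    q≢0 : NonZero q
    q≢0 = prime⇒nonZero q-prime
  ℓ⊥m : Coprime ℓ m
  ℓ⊥m = prime∤⇒coprime ℓ-prime (λ ℓ∣m → ℓ²∤q-1 (subst (ℓ * ℓ ∣_) (sym q-1≡mℓ) (*-monoˡ-∣ ℓ ℓ∣m)))
  module C = Curve ℓ q m ℓ-prime q-prime q≢ℓ q-1≡mℓ ℓ⊥m
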